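{- Consider the following static algorithm on a set system $(\mathcal{S},\mathcal{E})$ with costs $1/C\le c_s\le 1$, $n=|\mathcal{E}|$, every element contained in at least one set, and $0<\epsilon<1/2$. Initialize $L=\lceil\log_{1+\epsilon}(Cn)\rceil+1$, $w(e)=(1+\epsilon)^{ -L}$ and $\ell(e)=L$ for every element, and $\ell(s)=L$ for every set. For rounds $t=L,L-1,\dots,1$: let $\mathcal{S}^{(t)}_{slack}=\{s\in\mathcal{S}: W(s)<(1+\epsilon)^{ -1}c_s\}$ (with $W(s)=\sum_{e\in s}w(e)$ computed at the beginning of the round) and $\mathcal{E}^{(t)}_{slack}=\{e\in\mathcal{E}: e\notin s\text{ for all } s\in\mathcal{S}\setminus\mathcal{S}^{(t)}_{slack}\}$; decrease $\ell(s)$ by one for every $s\in\mathcal{S}^{(t)}_{slack}$; for every $e\in\mathcal{E}^{(t)}_{slack}$ multiply $w(e)$ by $(1+\epsilon)$ and decrease $\ell(e)$ by one. Then in round $t=1$ we have $\mathcal{E}^{(1)}_{slack}=\emptyset$.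
   Formalization: The parameters ε and C and the costs $c_s$ are rational. -}

module Defs where

open import Data.Bool using (Bool; true; false; if_then_else_)
open import Data.Nat as ℕ using (ℕ; zero; suc)
open import Data.Fin using (Fin; zero; suc)
open import Data.Fin.Properties using (all?)
open import Data.Integer as ℤ using (ℤ)
open import Data.Rational hiding (round)
open import Data.Rational.Properties using (_≟_; _<?_)
open import Data.Product using (_×_)
open import Relation.Nullary using (Dec; yes; no; does; ¬_)
open import Relation.Binary.PropositionalEquality using (_≡_)

pow : ℚ → ℕ → ℚ
pow q zero    = 1ℚ
pow q (suc k) = q * pow q k

-- total inverse (agrees with 1/_ on nonzero inputs; only ever applied to nonzero values here)
inv : ℚ → ℚ
inv p with p ≟ 0ℚ
... | yes _  = 0ℚ
... | no p≢0 = 1/_ p {{≢-nonZero p≢0}}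

ℕtoℚ : ℕ → ℚ
ℕtoℚ n = ℤ.+ n / 1

sumFin : (n : ℕ) → (Fin n → ℚ) → ℚ
sumFin zero    f = 0ℚ
sumFin (suc n) f = f zero + sumFin n (λ i → f (suc i))

-- IsCeilLog b x k : k is the least natural number with x ≤ b ^ k.
-- For b > 1 and x ≥ 1 this says exactly k = ⌈log_b x⌉.
IsCeilLog : ℚ → ℚ → ℕ → Set
IsCeilLog b x k = (x ≤ pow b k) × (∀ j → j ℕ.< k → pow b j < x)

-- A set system with m sets over the ground set Fin n; mem s e = true iff e ∈ s.
-- State of the algorithm: element weights w(e), element levels ℓ(e), set levels ℓ(s).
record State (m n : ℕ) : Set where
  constructor mkState
  field
    w  : Fin n → ℚ
    ℓE : Fin n → ℤ
    ℓS : Fin m → ℤ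
open State public

module Algorithm {m n : ℕ} (mem : Fin m → Fin n → Bool) (c : Fin m → ℚ) (ε : ℚ) where

  W : State m n → Fin m → ℚ
  W st s = sumFin n (λ e → if mem s e then w st e else 0ℚ)

  SlackSet : State m n → Fin m → Set
  SlackSet st s = W st s < inv (1ℚ + ε) * c s

  slackSet? : (st : State m n) (s : Fin m) → Dec (SlackSet st s)
  slackSet? st s = W st s <? inv (1ℚ + ε) * c s

  -- e ∈ E_slack  iff  e ∉ s for all s ∈ S ∖ S_slack,
  -- i.e. every set containing e is slack
  SlackElem : State m n → Fin n → Set
  SlackElem st e = ∀ s → mem s e ≡ true → SlackSet st s

  slackElem? : (st : State m n) (e : Fin n) → Dec (SlackElem st e)
  slackElem? st e = all? (λ s → dec s)
    where
    dec : (s : Fin m) → Dec (mem s e ≡ true → SlackSet st s)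
    dec s with mem s e
    ... | false = yes (λ ())
    ... | true with slackSet? st s
    ...   | yes p = yes (λ _ → p)
    ...   | no ¬p = no (λ f → ¬p (f _≡_.refl))

  init : ℕ → State m n
  init L = mkState (λ _ → inv (pow (1ℚ + ε) L)) (λ _ → ℤ.+ L) (λ _ → ℤ.+ L)

  -- one doRound (slack sets computed from the state at the beginning of the doRound)
  doRound : State m n → State m n
  doRound st = mkState
    (λ e → if does (slackElem? st e) then (1ℚ + ε) * w st e else w st e)
    (λ e → if does (slackElem? st e) then ℓE st e ℤ.- ℤ.+ 1 else ℓE st e)
    (λ s → if does (slackSet? st s) then ℓS st s ℤ.- ℤ.+ 1 else ℓS st s)

  after : ℕ → ℕ → State m n
  after L zero    = init L
  after L (suc k) = doRound (after L k)

module Submission where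

-- Write q = 1 + ε.  Weights only ever grow (an element's weight is either kept
-- or multiplied by q ≥ 1), so every W(s) is non-decreasing over the rounds and
-- a set that is slack now was slack in every earlier round.  Hence an element
-- that is slack in the last round (after L - 1 rounds) was slack in every round,
-- its weight was multiplied by q every time, and it equals
-- q^(L-1) · q^(-L) = 1/q.  But e lies in some set s, which is also slack, so
--   1/q = w(e) ≤ W(s) < c_s / q ≤ 1/q,
-- a contradiction.  Note that only c_s ≤ 1, ε ≥ 0 and the covering assumption
-- are used.

open import Defs
open import Data.Bool using (Bool; true; false; if_then_else_)
open import Data.Nat as ℕ using (ℕ; zero; suc)
import Data.Nat.Properties as ℕₚ
open import Data.Fin using (Fin; zero; suc)
open import Data.Rational using (ℚ; _<_; _≤_; 0ℚ; 1ℚ; ½; _+_; _*_; 1/_; positive; nonNegative; ≢-nonZero)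
open import Data.Rational.Properties
open import Data.Product using (∃; _,_)
open import Data.Empty using (⊥-elim)
open import Relation.Nullary using (¬_; Dec; yes; no; does)
open import Relation.Binary.PropositionalEquality

inv-unique : ∀ x p → x * p ≡ 1ℚ → x ≡ inv p
inv-unique x p xp≡1 with p ≟ 0ℚ
... | yes refl = ⊥-elim (1≢0 (trans (sym xp≡1) (*-zeroʳ x)))
... | no p≢0 = begin
    x                  ≡⟨ sym (*-identityʳ x) ⟩
    x * 1ℚ             ≡⟨ cong (x *_) (sym (*-inverseʳ p)) ⟩
    x * (p * 1/p)      ≡⟨ sym (*-assoc x p 1/p) ⟩
    (x * p) * 1/p      ≡⟨ cong (_* 1/p) xp≡1 ⟩
    1ℚ * 1/p           ≡⟨ *-identityˡ 1/p ⟩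
    1/p                ∎
  where
  open ≡-Reasoning
  instance _ = ≢-nonZero p≢0
  1/p : ℚ
  1/p = 1/ p

inv-inverseˡ : ∀ p → p ≢ 0ℚ → inv p * p ≡ 1ℚ
inv-inverseˡ p p≢0 with p ≟ 0ℚ
... | yes p≡0  = ⊥-elim (p≢0 p≡0)
... | no p≢0′ = *-inverseˡ p {{≢-nonZero p≢0′}}

inv-pos : ∀ p → 0ℚ < p → 0ℚ < inv p
inv-pos p p>0 with p ≟ 0ℚ
... | yes refl = ⊥-elim (<-irrefl refl p>0)
... | no _ = positive⁻¹ _ {{1/pos⇒pos p {{positive p>0}}}}

pow-pos : ∀ {b} → 0ℚ < b → ∀ k → 0ℚ < pow b k
pow-pos b>0 zero    = positive⁻¹ 1ℚ
pow-pos {b} b>0 (suc k) =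
  positive⁻¹ (b * pow b k) {{pos*pos⇒pos b {{positive b>0}} (pow b k) {{positive (pow-pos b>0 k)}}}}

≤-scaleUp : ∀ {q x} → 1ℚ ≤ q → 0ℚ ≤ x → x ≤ q * x
≤-scaleUp {q} {x} 1≤q x≥0 =
  subst (_≤ q * x) (*-identityˡ x) (*-monoʳ-≤-nonNeg x {{nonNegative x≥0}} 1≤q)

≤-scaleDown : ∀ {a b} → 0ℚ ≤ a → b ≤ 1ℚ → a * b ≤ a
≤-scaleDown {a} a≥0 b≤1 =
  ≤-trans (*-monoˡ-≤-nonNeg a {{nonNegative a≥0}} b≤1) (≤-reflexive (*-identityʳ a))

if-does-yes : ∀ {P : Set} {A : Set} (d : Dec P) {a b : A} → P → (if does d then a else b) ≡ a
if-does-yes (yes _) _ = refl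
if-does-yes (no ¬p) p = ⊥-elim (¬p p)

sumFin-mono : ∀ n {f g : Fin n → ℚ} → (∀ i → f i ≤ g i) → sumFin n f ≤ sumFin n g
sumFin-mono zero    f≤g = ≤-refl
sumFin-mono (suc n) f≤g = +-mono-≤ (f≤g zero) (sumFin-mono n (λ i → f≤g (suc i)))

sumFin-nonNeg : ∀ n {f : Fin n → ℚ} → (∀ i → 0ℚ ≤ f i) → 0ℚ ≤ sumFin n f
sumFin-nonNeg zero    f≥0 = ≤-refl
sumFin-nonNeg (suc n) {f} f≥0 =
  subst (_≤ sumFin (suc n) f) (+-identityʳ 0ℚ) (+-mono-≤ (f≥0 zero) (sumFin-nonNeg n (λ i → f≥0 (suc i))))

term≤sumFin : ∀ n {f : Fin n → ℚ} → (∀ i → 0ℚ ≤ f i) → ∀ j → f j ≤ sumFin n f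
term≤sumFin (suc n) {f} f≥0 zero =
  subst (_≤ sumFin (suc n) f) (+-identityʳ (f zero)) (+-monoʳ-≤ (f zero) (sumFin-nonNeg n (λ i → f≥0 (suc i))))
term≤sumFin (suc n) {f} f≥0 (suc j) =
  subst (_≤ sumFin (suc n) f) (+-identityˡ (f (suc j))) (+-mono-≤ (f≥0 zero) (term≤sumFin n (λ i → f≥0 (suc i)) j))

module RoundProperties {m n : ℕ} (mem : Fin m → Fin n → Bool) (c : Fin m → ℚ)
                       (ε : ℚ) (ε≥0 : 0ℚ ≤ ε) where
  open Algorithm mem c ε

  q : ℚ
  q = 1ℚ + ε

  1≤q : 1ℚ ≤ q
  1≤q = subst (_≤ q) (+-identityʳ 1ℚ) (+-monoʳ-≤ 1ℚ ε≥0)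

  q>0 : 0ℚ < q
  q>0 = <-≤-trans (positive⁻¹ 1ℚ) 1≤q

  -- the invariant that keeps all rounds monotone
  NonNegWeights : State m n → Set
  NonNegWeights st = ∀ e → 0ℚ ≤ w st e

  _≤w_ : State m n → State m n → Set
  st ≤w st′ = ∀ e → w st e ≤ w st′ e

  W-mono : ∀ {st st′} → st ≤w st′ → ∀ s → W st s ≤ W st′ s
  W-mono {st} {st′} st≤st′ s = sumFin-mono n term-mono
    where
    term-mono : ∀ e → (if mem s e then w st e else 0ℚ) ≤ (if mem s e then w st′ e else 0ℚ)
    term-mono e with mem s e
    ... | true  = st≤st′ e
    ... | false = ≤-refl

  slackSet-anti : ∀ {st st′} → st ≤w st′ → ∀ s → SlackSet st′ s → SlackSet st s
  slackSet-anti {st} {st′} st≤st′ s = ≤-<-trans (W-mono {st} {st′} st≤st′ s)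

  slackElem-anti : ∀ {st st′} → st ≤w st′ → ∀ e → SlackElem st′ e → SlackElem st e
  slackElem-anti {st} {st′} st≤st′ e slack s e∈s = slackSet-anti {st} {st′} st≤st′ s (slack s e∈s)

  member≤W : ∀ {st} → NonNegWeights st → ∀ {s e} → mem s e ≡ true → w st e ≤ W st s
  member≤W {st} w≥0 {s} {e} e∈s =
    subst (λ b → (if b then w st e else 0ℚ) ≤ W st s) e∈s (term≤sumFin n term≥0 e)
    where
    term≥0 : ∀ e′ → 0ℚ ≤ (if mem s e′ then w st e′ else 0ℚ)
    term≥0 e′ with mem s e′
    ... | true  = w≥0 e′
    ... | false = ≤-refl

  doRound-grows : ∀ {st} → NonNegWeights st → st ≤w doRound st
  doRound-grows {st} w≥0 e with does (slackElem? st e)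
  ... | true  = ≤-scaleUp 1≤q (w≥0 e)
  ... | false = ≤-refl

  doRound-nonNeg : ∀ {st} → NonNegWeights st → NonNegWeights (doRound st)
  doRound-nonNeg w≥0 e = ≤-trans (w≥0 e) (doRound-grows w≥0 e)

  doRound-slack : ∀ st e → SlackElem st e → w (doRound st) e ≡ q * w st e
  doRound-slack st e slack = if-does-yes (slackElem? st e) slack

module RunProperties {m n : ℕ} (mem : Fin m → Fin n → Bool) (c : Fin m → ℚ)
                     (ε : ℚ) (ε≥0 : 0ℚ ≤ ε) (L : ℕ) where
  open Algorithm mem c ε
  open RoundProperties mem c ε ε≥0

  after-nonNeg : ∀ k → NonNegWeights (after L k)
  after-nonNeg zero    e = <⇒≤ (inv-pos _ (pow-pos q>0 L))
  after-nonNeg (suc k) = doRound-nonNeg (after-nonNeg k)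

  slack-history : ∀ k e → SlackElem (after L (suc k)) e → SlackElem (after L k) e
  slack-history k = slackElem-anti {after L k} {after L (suc k)} (doRound-grows (after-nonNeg k))

  -- Weight invariant: an element slack after k rounds was multiplied by q in
  -- each of them, so its weight is q^k · q^(-L); i.e. it times q^j is 1 when j + k = L.
  slack-weight : ∀ e j k → j ℕ.+ k ≡ L → SlackElem (after L k) e
               → w (after L k) e * pow q j ≡ 1ℚ
  slack-weight e j zero j+0≡L _ =
    subst (λ i → inv (pow q L) * pow q i ≡ 1ℚ) (trans (sym j+0≡L) (ℕₚ.+-identityʳ j))
      (inv-inverseˡ (pow q L) (≢-sym (<⇒≢ (pow-pos q>0 L))))
  slack-weight e j (suc k) j+k+1≡L slack = begin
    w (after L (suc k)) e * pow q j  ≡⟨ cong (_* pow q j) (doRound-slack (after L k) e earlier) ⟩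
    (q * w′) * pow q j               ≡⟨ cong (_* pow q j) (*-comm q w′) ⟩
    (w′ * q) * pow q j               ≡⟨ *-assoc w′ q (pow q j) ⟩
    w′ * pow q (suc j)               ≡⟨ slack-weight e (suc j) k (trans (sym (ℕₚ.+-suc j k)) j+k+1≡L) earlier ⟩
    1ℚ                               ∎
    where
    open ≡-Reasoning
    earlier = slack-history k e slack
    w′ = w (after L k) e

-- Corollary A.3: no element is slack in the last round t = 1, i.e. after L - 1 rounds.
corollaryA3 : (m n : ℕ) (mem : Fin m → Fin n → Bool) (C : ℚ) (c : Fin m → ℚ) (ε : ℚ)
    → 0ℚ < C
    → (∀ s → inv C ≤ c s)
    → (∀ s → c s ≤ 1ℚ)
    → (∀ e → ∃ λ s → mem s e ≡ true)
    → 0ℚ < ε → ε < ½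
    → (L L₀ : ℕ) → IsCeilLog (1ℚ + ε) (C * ℕtoℚ n) L₀ → L ≡ suc L₀
    → let open Algorithm mem c ε in
      ∀ e → ¬ SlackElem (after L (L ℕ.∸ 1)) e
corollaryA3 m n mem C c ε _ _ c≤1 covered ε>0 _ .(suc L₀) L₀ _ refl e slack =
  <-irrefl weight≡1/q weight<1/q
  where
  open Algorithm mem c ε
  open RoundProperties mem c ε (<⇒≤ ε>0)
  open RunProperties mem c ε (<⇒≤ ε>0) (suc L₀)
  open ≤-Reasoning

  last : State m n
  last = after (suc L₀) L₀

  -- e was slack in every round, so its weight has grown to q^(L-1) · q^(-L) = 1/q
  weight≡1/q : w last e ≡ inv q
  weight≡1/q = inv-unique (w last e) q
    (trans (cong (w last e *_) (sym (*-identityʳ q))) (slack-weight e 1 L₀ refl slack))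

  -- but e lies in a set s, which is slack as well
  weight<1/q : w last e < inv q
  weight<1/q with covered e
  ... | s , e∈s = begin-strict
    w last e     ≤⟨ member≤W {last} (after-nonNeg L₀) e∈s ⟩
    W last s     <⟨ slack s e∈s ⟩
    inv q * c s  ≤⟨ ≤-scaleDown (<⇒≤ (inv-pos q q>0)) (c≤1 s) ⟩
    inv q        ∎
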